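{- There exists a semilinear equivariant deterministic finite automaton with the integer atoms, with state set $Q$, such that the equivalences $\sim_n$ ($n\in\mathbb{N}$) on $Q$ never stabilize, i.e.\ there is no $n$ with $\sim_n\,=\,\sim_{n+1}$; here $p\sim_n q$ iff the states $p$ and $q$ accept the same input words of length at most $n$.
   Context: Integer atoms: the atoms are the integers $\mathbb{Z}$ with the successor function; the automorphisms are exactly the translations $x\mapsto x+z$, acting hereditarily on sets built from atoms. A set, relation or function is equivariant if invariant under all translations; an equivariant set is orbit-finite if it is a finite union of orbits. For $k\ge1$, $\mathbb{Z}_k$ is the integers modulo $k$ with translations acting by addition, $\mathbb{Z}_0=\mathbb{Z}$; every equivariant single-orbit set is equivariantly isomorphic to some $\mathbb{Z}_k$. A monomial set is a finite product of equivariant single-orbit sets, a polynomial set a finite disjoint union of monomials. A subset of $\mathbb{Z}^m$ is semilinear if Presburger-definable; every subset of $\mathbb{Z}_k$ ($k\ge1$) is semilinear; subsets of general monomials and polynomial sets are semilinear if semilinear after transport along equivariant isomorphisms to disjoint unions of monomials $\mathbb{Z}^m$, $\mathbb{Z}_k$ (via $\mathbb{Z}_k\times\mathbb{Z}\cong k$ copies of $\mathbb{Z}$, $\mathbb{Z}_k\times\mathbb{Z}_l\cong\mathbb{Z}_{\mathrm{lcm}(k,l)}$), componentwise. A DFA with atoms consists of an orbit-finite equivariant alphabet $A$, an orbit-finite equivariant state set $Q$, a transition function $\delta:Q\times A\to Q$, an initial state and accepting states $F\subseteq Q$; it is equivariant if $\delta$, the initial state and $F$ are equivariant, and semilinear if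 $\delta$ is a semilinear subset of $Q\times A\times Q$. A state $q$ accepts a word $w$ if reading $w$ from $q$ ends in $F$. -}

module Defs where

open import Data.Nat as ℕ using (ℕ; zero; suc; _≤_)
open import Data.Integer as ℤ using (ℤ; +_)
open import Data.Integer.DivMod using (_%ℕ_; n%ℕd<d)
open import Data.Fin as Fin using (Fin; fromℕ<; toℕ)
open import Data.List using (List; []; _∷_; length; foldl)
open import Data.Bool using (Bool)
open import Data.Product using (Σ; _×_; _,_; ∃)
open import Data.Sum using (_⊎_)
open import Data.Empty using (⊥)
open import Data.Vec.Functional as VF using (Vector)
open import Relation.Binary.PropositionalEquality using (_≡_)
open import Function.Bundles using (_⇔_)
open import Relation.Nullary using (¬_)

-- Integer atoms: single-orbit equivariant sets ℤ_k
-- ℤ_0 = ℤ, ℤ_(k+1) = integers modulo k+1 (represented by Fin (k+1)).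

Zk : ℕ → Set
Zk zero    = ℤ
Zk (suc k) = Fin (suc k)

proj : (k : ℕ) → ℤ → Zk k
proj zero    x = x
proj (suc k) x = fromℕ< (n%ℕd<d x (suc k))

rep : (k : ℕ) → Zk k → ℤ
rep zero    x = x
rep (suc k) a = + toℕ a

actZ : (k : ℕ) → ℤ → Zk k → Zk k
actZ k z a = proj k (rep k a ℤ.+ z)

-- Orbit-finite equivariant sets, in the normal form of a finite disjoint
-- union of single-orbit sets ℤ_{k_0} ⊎ … ⊎ ℤ_{k_{n-1}} (a polynomial set
-- whose monomials are single-orbit).

record OFSet : Set where
  field
    orbits : ℕ
    kind   : Fin orbits → ℕ

El : OFSet → Set
El X = Σ (Fin (OFSet.orbits X)) (λ i → Zk (OFSet.kind X i))

act : (X : OFSet) → ℤ → El X → El X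
act X z (i , a) = i , actZ (OFSet.kind X i) z a

data Term (n : ℕ) : Set where
  var   : Fin n → Term n
  const : ℤ → Term n
  _⊕_   : Term n → Term n → Term n
  _⊛_   : ℤ → Term n → Term n

data Formula (n : ℕ) : Set where
  _≤ᶠ_ : Term n → Term n → Formula n
  _≐_  : Term n → Term n → Formula n
  ¬ᶠ_  : Formula n → Formula n
  _∧ᶠ_ : Formula n → Formula n → Formula n
  _∨ᶠ_ : Formula n → Formula n → Formula n
  ∃ᶠ   : Formula (suc n) → Formula n

⟦_⟧ₜ : ∀ {n} → Term n → Vector ℤ n → ℤ
⟦ var i ⟧ₜ   ρ = ρ i
⟦ const c ⟧ₜ ρ = c
⟦ s ⊕ t ⟧ₜ   ρ = ⟦ s ⟧ₜ ρ ℤ.+ ⟦ t ⟧ₜ ρ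
⟦ c ⊛ t ⟧ₜ   ρ = c ℤ.* ⟦ t ⟧ₜ ρ

⟦_⟧ : ∀ {n} → Formula n → Vector ℤ n → Set
⟦ s ≤ᶠ t ⟧ ρ = ⟦ s ⟧ₜ ρ ℤ.≤ ⟦ t ⟧ₜ ρ
⟦ s ≐ t ⟧  ρ = ⟦ s ⟧ₜ ρ ≡ ⟦ t ⟧ₜ ρ
⟦ ¬ᶠ φ ⟧   ρ = ¬ ⟦ φ ⟧ ρ
⟦ φ ∧ᶠ ψ ⟧ ρ = ⟦ φ ⟧ ρ × ⟦ ψ ⟧ ρ
⟦ φ ∨ᶠ ψ ⟧ ρ = ⟦ φ ⟧ ρ ⊎ ⟦ ψ ⟧ ρ
⟦ ∃ᶠ φ ⟧   ρ = ∃ λ (x : ℤ) → ⟦ φ ⟧ (x VF.∷ ρ)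

-- a subset of ℤ^n is semilinear iff Presburger-definable
SemilinearZ : (n : ℕ) → (Vector ℤ n → Set) → Set
SemilinearZ n P = Σ (Formula n) λ φ → ∀ ρ → ⟦ φ ⟧ ρ ⇔ P ρ

record DFA : Set₁ where
  field
    A     : OFSet
    Q     : OFSet
    δ     : El Q → El A → El Q
    q₀    : El Q
    F     : El Q → Bool

module _ (M : DFA) where
  open DFA M

  Equivariant : Set
  Equivariant =
      (∀ z q a → δ (act Q z q) (act A z a) ≡ act Q z (δ q a))
    × (∀ z → act Q z q₀ ≡ q₀)
    × (∀ z q → F (act Q z q) ≡ F q)

  -- δ ⊆ Q × A × Q is semilinear: on each monomial component
  -- ℤ_{k_i} × ℤ_{a_j} × ℤ_{k_l}, its preimage under the canonical
  -- projection ℤ³ → ℤ_{k_i} × ℤ_{a_j} × ℤ_{k_l} is Presburger-definable.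
  Semilinear : Set
  Semilinear =
    ∀ (i : Fin (OFSet.orbits Q)) (j : Fin (OFSet.orbits A)) (l : Fin (OFSet.orbits Q)) →
    SemilinearZ 3 λ ρ →
      δ (i , proj (OFSet.kind Q i) (ρ Fin.zero))
        (j , proj (OFSet.kind A j) (ρ (Fin.suc Fin.zero)))
      ≡ (l , proj (OFSet.kind Q l) (ρ (Fin.suc (Fin.suc Fin.zero))))

  run : El Q → List (El A) → El Q
  run q []      = q
  run q (a ∷ w) = run (δ q a) w

  _∼[_]_ : El Q → ℕ → El Q → Set
  p ∼[ n ] q = ∀ (w : List (El A)) → length w ≤ n → F (run p w) ≡ F (run q w)

  Stabilizes-at : ℕ → Set
  Stabilizes-at n = ∀ p q → (p ∼[ n ] q) ⇔ (p ∼[ suc n ] q)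

module Submission where

-- States are the integers (one orbit of "positions")
-- together with a rejecting sink (an orbit ℤ₁); letters are integers.
-- From position x, a letter a with a − x even leads to the midpoint
-- (x + a)/2, and a letter with a − x odd leads to the sink.  Every
-- position is accepting and the sink rejects.  Transitions commute with
-- translations and are defined by parity/halving, hence Presburger.
--
-- Why ∼ₙ never stabilises: one letter halves the distance between two
-- positions and preserves the parity of a − x whenever that distance is
-- even, so by induction positions x and x + d·2ⁿ agree on all words of
-- length ≤ n.  Yet 0 and 2ⁿ are told apart by the word 0ⁿ⁺¹: position 0
-- stays at 0, while 2ⁿ halves down to 1 and then falls into the sink.

open import Defs
open import Data.Nat using (ℕ)
open import Data.Product using (Σ; _×_)
open import Relation.Nullary using (¬_)

open import Data.Nat as ℕ using (zero; suc; s≤s; z≤n)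
open import Data.Integer as ℤ using (ℤ; +_; _+_; _-_; _*_; _^_; -_; ∣_∣)
import Data.Integer.Properties as ℤP
import Data.Nat.Properties as ℕP
open import Data.Integer.DivMod using (_%ℕ_; _/ℕ_; n%ℕd<d; a≡a%ℕn+[a/ℕn]*n)
open import Data.Integer.Tactic.RingSolver using (solve-∀)
open import Data.Fin as Fin using (Fin)
open import Data.List using (List; []; _∷_; replicate)
open import Data.List.Properties using (length-replicate)
open import Data.Bool using (Bool; true; false)
open import Data.Product using (_,_; ∃)
open import Data.Sum using (_⊎_; inj₁; inj₂)
open import Data.Empty using (⊥-elim)
open import Relation.Binary.PropositionalEquality
open import Function.Bundles using (mk⇔; Equivalence)

same-quotient : ∀ h k → (h - k) * + 2 ≡ + 0 → h ≡ k
same-quotient h k d = ℤP.i-j≡0⇒i≡j h k (ℤP.*-cancelʳ-≡ (h - k) (+ 0) (+ 2) d)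

halves-difference : ∀ r s h k → r + h * + 2 ≡ s + k * + 2 → (h - k) * + 2 ≡ s - r
halves-difference r s h k e = begin
  (h - k) * + 2                             ≡⟨ rearrange h k r s ⟩
  ((r + h * + 2) - (s + k * + 2)) + (s - r) ≡⟨ cong (λ v → (v - (s + k * + 2)) + (s - r)) e ⟩
  ((s + k * + 2) - (s + k * + 2)) + (s - r) ≡⟨ cong (_+ (s - r)) (ℤP.+-inverseʳ (s + k * + 2)) ⟩
  + 0 + (s - r)                             ≡⟨ ℤP.+-identityˡ (s - r) ⟩
  s - r                                     ∎
  where
  open ≡-Reasoning
  rearrange : ∀ h k r s → (h - k) * + 2 ≡ ((r + h * + 2) - (s + k * + 2)) + (s - r)
  rearrange = solve-∀

-- An even integer has even absolute value, so it is never ±1.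
double-not-unit : ∀ i → ∣ i * + 2 ∣ ≢ 1
double-not-unit i e = odd-not-double ∣ i ∣ (trans (sym (ℤP.abs-* i (+ 2))) e)
  where
  odd-not-double : ∀ m → m ℕ.* 2 ≢ 1
  odd-not-double zero ()
  odd-not-double (suc m) ()

halves-unique : ∀ r s h k → r ℕ.< 2 → s ℕ.< 2 →
                + r + h * + 2 ≡ + s + k * + 2 → (r ≡ s) × (h ≡ k)
halves-unique zero zero h k _ _ e = refl , same-quotient h k (halves-difference (+ 0) (+ 0) h k e)
halves-unique 1    1    h k _ _ e = refl , same-quotient h k (halves-difference (+ 1) (+ 1) h k e)
halves-unique zero 1    h k _ _ e =
  ⊥-elim (double-not-unit (h - k) (cong ∣_∣ (halves-difference (+ 0) (+ 1) h k e)))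
halves-unique 1    zero h k _ _ e =
  ⊥-elim (double-not-unit (h - k) (cong ∣_∣ (halves-difference (+ 1) (+ 0) h k e)))
halves-unique (suc (suc _)) _ _ _ (s≤s (s≤s ())) _ _
halves-unique _ (suc (suc _)) _ _ _ (s≤s (s≤s ())) _

divmod-2 : ∀ t r h → r ℕ.< 2 → t ≡ + r + h * + 2 → (t %ℕ 2 ≡ r) × (t /ℕ 2 ≡ h)
divmod-2 t r h r<2 e =
  halves-unique (t %ℕ 2) r (t /ℕ 2) h (n%ℕd<d t 2) r<2 (trans (sym (a≡a%ℕn+[a/ℕn]*n t 2)) e)

States : OFSet
States = record { orbits = 2 ; kind = λ { Fin.zero → 0 ; (Fin.suc _) → 1 } }

Letters : OFSet
Letters = record { orbits = 1 ; kind = λ _ → 0 }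

pos : ℤ → El States
pos x = Fin.zero , x

sink : El States
sink = Fin.suc Fin.zero , Fin.zero

move : ℕ → ℤ → ℤ → El States
move zero    h x = pos (x + h)
move (suc _) h x = sink

step : ℤ → ℤ → El States
step x a = move ((a - x) %ℕ 2) ((a - x) /ℕ 2) x

δ : El States → El Letters → El States
δ (Fin.zero , x)          (_ , a) = step x a
δ (Fin.suc Fin.zero , _)  _       = sink

accepting : El States → Bool
accepting (Fin.zero , _)          = true
accepting (Fin.suc Fin.zero , _)  = false

halving : DFA
halving = record { A = Letters ; Q = States ; δ = δ ; q₀ = sink ; F = accepting }

sink-unique : (i : Fin 1) → (Fin.suc Fin.zero , i) ≡ sink
sink-unique Fin.zero = refl

step-by-halves : ∀ x a r h → r ℕ.< 2 → a - x ≡ + r + h * + 2 → step x a ≡ move r h x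
step-by-halves x a r h r<2 e with divmod-2 (a - x) r h r<2 e
... | refl , refl = refl

step-even : ∀ x a h → a ≡ x + (h + h) → step x a ≡ pos (x + h)
step-even x .(x + (h + h)) h refl =
  step-by-halves x (x + (h + h)) 0 h (s≤s z≤n) (even-difference x h)
  where
  even-difference : ∀ x h → (x + (h + h)) - x ≡ + 0 + h * + 2
  even-difference = solve-∀

step-odd : ∀ x a h → a ≡ x + (h + h) + + 1 → step x a ≡ sink
step-odd x .(x + (h + h) + + 1) h refl =
  step-by-halves x (x + (h + h) + + 1) 1 h (s≤s (s≤s z≤n)) (odd-difference x h)
  where
  odd-difference : ∀ x h → (x + (h + h) + + 1) - x ≡ + 1 + h * + 2
  odd-difference = solve-∀

difference-inverse : ∀ a x t → a - x ≡ t → a ≡ x + t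
difference-inverse a x t e = trans (recompose a x) (cong (λ v → x + v) e)
  where
  recompose : ∀ a x → a ≡ x + (a - x)
  recompose = solve-∀

letter-parity : ∀ x a → (∃ λ h → a ≡ x + (h + h)) ⊎ (∃ λ h → a ≡ x + (h + h) + + 1)
letter-parity x a = classify ((a - x) %ℕ 2) ((a - x) /ℕ 2) (n%ℕd<d (a - x) 2) (a≡a%ℕn+[a/ℕn]*n (a - x) 2)
  where
  classify : ∀ r h → r ℕ.< 2 → a - x ≡ + r + h * + 2 →
             (∃ λ h → a ≡ x + (h + h)) ⊎ (∃ λ h → a ≡ x + (h + h) + + 1)
  classify zero h _ e = inj₁ (h , trans (difference-inverse a x _ e) (even-form x h))
    where
    even-form : ∀ x h → x + (+ 0 + h * + 2) ≡ x + (h + h)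
    even-form = solve-∀
  classify 1 h _ e = inj₂ (h , trans (difference-inverse a x _ e) (odd-form x h))
    where
    odd-form : ∀ x h → x + (+ 1 + h * + 2) ≡ x + (h + h) + + 1
    odd-form = solve-∀
  classify (suc (suc _)) _ (s≤s (s≤s ())) _

sink-invariant : ∀ z → act States z sink ≡ sink
sink-invariant z = sink-unique _

move-translate : ∀ r h x z → move r h (x + z) ≡ act States z (move r h x)
move-translate zero    h x z = cong pos (reorder x z h)
  where
  reorder : ∀ x z h → x + z + h ≡ x + h + z
  reorder = solve-∀
move-translate (suc _) h x z = sym (sink-invariant z)

-- A transition only depends on the difference a − x.
step-translate : ∀ x a z → step (x + z) (a + z) ≡ act States z (step x a)
step-translate x a z =
  trans (cong (λ t → move (t %ℕ 2) (t /ℕ 2) (x + z)) (same-difference a x z)) (move-translate _ _ x z)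
  where
  same-difference : ∀ a x z → (a + z) - (x + z) ≡ a - x
  same-difference = solve-∀

halving-equivariant : Equivariant halving
halving-equivariant = δ-equivariant , sink-invariant , accepting-invariant
  where
  δ-equivariant : ∀ z q a → δ (act States z q) (act Letters z a) ≡ act States z (δ q a)
  δ-equivariant z (Fin.zero , x)         (Fin.zero , a) = step-translate x a z
  δ-equivariant z (Fin.suc Fin.zero , _) (Fin.zero , a) = sym (sink-invariant z)
  accepting-invariant : ∀ z q → accepting (act States z q) ≡ accepting q
  accepting-invariant z (Fin.zero , _)         = refl
  accepting-invariant z (Fin.suc Fin.zero , _) = refl

-- Under one existential, variable 0 is the witness k; x, a, y follow.
k′ x′ a′ y′ : Term 4
k′ = var Fin.zero
x′ = var (Fin.suc Fin.zero)
a′ = var (Fin.suc (Fin.suc Fin.zero))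
y′ = var (Fin.suc (Fin.suc (Fin.suc Fin.zero)))

halving-step : ∀ x a y → (∃ λ k → (a ≡ x + (k + k)) × (y ≡ x + k)) → step x a ≡ pos y
halving-step x a y (k , a≡ , refl) = step-even x a k a≡

halving-step⁻¹ : ∀ x a y → step x a ≡ pos y → ∃ λ k → (a ≡ x + (k + k)) × (y ≡ x + k)
halving-step⁻¹ x a y s with letter-parity x a
... | inj₁ (h , a≡) = h , a≡ , pos-injective (trans (sym s) (step-even x a h a≡))
  where
  pos-injective : ∀ {u v} → pos u ≡ pos v → u ≡ v
  pos-injective refl = refl
... | inj₂ (h , a≡) with () ← trans (sym (step-odd x a h a≡)) s

falls-to-sink : ∀ x a i → (∃ λ k → a ≡ x + (k + k) + + 1) → step x a ≡ (Fin.suc Fin.zero , i)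
falls-to-sink x a i (k , a≡) = trans (step-odd x a k a≡) (sym (sink-unique i))

falls-to-sink⁻¹ : ∀ x a i → step x a ≡ (Fin.suc Fin.zero , i) → ∃ λ k → a ≡ x + (k + k) + + 1
falls-to-sink⁻¹ x a i s with letter-parity x a
... | inj₁ (h , a≡) with () ← trans (sym (step-even x a h a≡)) s
... | inj₂ odd = odd

halving-semilinear : Semilinear halving
halving-semilinear Fin.zero Fin.zero Fin.zero =
  ∃ᶠ ((a′ ≐ (x′ ⊕ (k′ ⊕ k′))) ∧ᶠ (y′ ≐ (x′ ⊕ k′))) ,
  λ ρ → mk⇔ (halving-step _ _ _) (halving-step⁻¹ _ _ _)
halving-semilinear Fin.zero Fin.zero (Fin.suc Fin.zero) =
  ∃ᶠ (a′ ≐ ((x′ ⊕ (k′ ⊕ k′)) ⊕ const (+ 1))) ,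
  λ ρ → mk⇔ (falls-to-sink _ _ _) (falls-to-sink⁻¹ _ _ _)
halving-semilinear (Fin.suc Fin.zero) Fin.zero Fin.zero =
  (const (+ 0) ≐ const (+ 1)) , λ ρ → mk⇔ (λ ()) (λ ())
halving-semilinear (Fin.suc Fin.zero) Fin.zero (Fin.suc Fin.zero) =
  (const (+ 0) ≐ const (+ 0)) , λ ρ → mk⇔ (λ _ → sym (sink-unique _)) (λ _ → refl)

-- A letter maps positions 2P·d apart either to positions P·d apart or
-- both to the sink, since a − x and a − (x + 2Pd) have the same parity.
step-halves-distance : ∀ P d x a →
  (∃ λ u → (step x a ≡ pos u) × (step (x + d * (+ 2 * P)) a ≡ pos (u + d * P)))
  ⊎ ((step x a ≡ sink) × (step (x + d * (+ 2 * P)) a ≡ sink))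
step-halves-distance P d x a with letter-parity x a
... | inj₁ (h , a≡) =
  inj₁ (x + h , step-even x a h a≡ ,
        trans (step-even _ a (h - d * P) (trans a≡ (even-shift x h d P))) (cong pos (midpoint-shift x h d P)))
  where
  even-shift : ∀ x h d P → x + (h + h) ≡ x + d * (+ 2 * P) + ((h - d * P) + (h - d * P))
  even-shift = solve-∀
  midpoint-shift : ∀ x h d P → x + d * (+ 2 * P) + (h - d * P) ≡ x + h + d * P
  midpoint-shift = solve-∀
... | inj₂ (h , a≡) =
  inj₂ (step-odd x a h a≡ , step-odd _ a (h - d * P) (trans a≡ (odd-shift x h d P)))
  where
  odd-shift : ∀ x h d P → x + (h + h) + + 1 ≡ x + d * (+ 2 * P) + ((h - d * P) + (h - d * P)) + + 1
  odd-shift = solve-∀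

verdict : List (El Letters) → El States → Bool
verdict w q = accepting (run halving q w)

positions-agree : ∀ m d x → _∼[_]_ halving (pos x) m (pos (x + d * (+ 2) ^ m))
positions-agree m d x [] _ = refl
positions-agree (suc m) d x ((Fin.zero , a) ∷ w) (s≤s len) with step-halves-distance ((+ 2) ^ m) d x a
... | inj₁ (u , from-x , from-y) = begin
  verdict w (step x a)                       ≡⟨ cong (verdict w) from-x ⟩
  verdict w (pos u)                          ≡⟨ positions-agree m d u w len ⟩
  verdict w (pos (u + d * (+ 2) ^ m))        ≡⟨ cong (verdict w) (sym from-y) ⟩
  verdict w (step (x + d * (+ 2) ^ suc m) a) ∎
  where open ≡-Reasoning
... | inj₂ (from-x , from-y) = cong (verdict w) (trans from-x (sym from-y))

zeros : ℕ → List (El Letters)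
zeros k = replicate k (Fin.zero , + 0)

-- The letter 0 is even relative to 0 and keeps position 0 fixed.
origin-fixed : ∀ k → run halving (pos (+ 0)) (zeros k) ≡ pos (+ 0)
origin-fixed zero    = refl
origin-fixed (suc k) = origin-fixed k

halve-power : ∀ n → step ((+ 2) ^ suc n) (+ 0) ≡ pos ((+ 2) ^ n)
halve-power n = trans (step-even _ (+ 0) (- P) (zero-form P)) (cong pos (midpoint P))
  where
  P = (+ 2) ^ n
  zero-form : ∀ P → + 0 ≡ + 2 * P + (- P + - P)
  zero-form = solve-∀
  midpoint : ∀ P → + 2 * P + - P ≡ P
  midpoint = solve-∀

-- Zeros take 2ⁿ down to 1, and a further zero (odd relative to 1) to the sink.
power-falls : ∀ n → run halving (pos ((+ 2) ^ n)) (zeros (suc n)) ≡ sink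
power-falls zero    = refl
power-falls (suc n) = trans (cong (λ q → run halving q (zeros (suc n))) (halve-power n)) (power-falls n)

origin-power-distinguished : ∀ n → ¬ _∼[_]_ halving (pos (+ 0)) (suc n) (pos ((+ 2) ^ n))
origin-power-distinguished n agree = true≢false (begin
  true                             ≡⟨ cong accepting (sym (origin-fixed (suc n))) ⟩
  verdict w (pos (+ 0))            ≡⟨ agree w (ℕP.≤-reflexive (length-replicate (suc n))) ⟩
  verdict w (pos ((+ 2) ^ n))      ≡⟨ cong accepting (power-falls n) ⟩
  false                            ∎)
  where
  open ≡-Reasoning
  w = zeros (suc n)
  true≢false : true ≢ false
  true≢false ()

origin-power-agree : ∀ n → _∼[_]_ halving (pos (+ 0)) n (pos ((+ 2) ^ n))
origin-power-agree n =
  subst (λ v → _∼[_]_ halving (pos (+ 0)) n (pos v)) (unit-shift _) (positions-agree n (+ 1) (+ 0))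
  where
  unit-shift : ∀ P → + 0 + + 1 * P ≡ P
  unit-shift = solve-∀

proposition2 : Σ DFA λ M → Equivariant M × Semilinear M × (∀ (n : ℕ) → ¬ Stabilizes-at M n)
proposition2 = halving , halving-equivariant , halving-semilinear , never-stabilizes
  where
  -- ∼ₙ relates 0 and 2ⁿ but ∼ₙ₊₁ does not.
  never-stabilizes : ∀ n → ¬ Stabilizes-at halving n
  never-stabilizes n stable =
    origin-power-distinguished n (Equivalence.to (stable _ _) (origin-power-agree n))
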